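{- Let $m,k$ be positive integers with $k\ge 4$. Then $C_k\,\Box\, C_{mk}$ admits a barbell partition.
   Context: $C_N$ denotes the cycle on $N$ vertices. $G\,\Box\,H$ has vertex set $V(G)\times V(H)$, with $(g_1,h_1)(g_2,h_2)$ an edge iff either $g_1=g_2$ and $h_1h_2\in E(H)$, or $h_1=h_2$ and $g_1g_2\in E(G)$. A barbell partition of a graph $K$ is a partition of $V(K)$ into three disjoint sets $\{R,W_1,W_2\}$ with $W_1,W_2\neq\emptyset$ ($R$ may be empty), no edges between $W_1$ and $W_2$, and $|N_K(r)\cap W_i|\neq 1$ for all $r\in R$, $i\in\{1,2\}$. -}

module Defs where

open import Data.Nat using (ℕ; suc; _%_; NonZero)
open import Data.Nat.Properties using (_≟_)
open import Data.Fin using (Fin; toℕ)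
open import Data.Fin.Properties using () renaming (_≟_ to _≟ᶠ_)
open import Data.Bool using (Bool; true; false; _∨_; _∧_; T)
open import Data.List using (List; length; filter; allFin; cartesianProduct)
open import Data.Product using (_×_; _,_; ∃)
open import Relation.Nullary.Decidable using (⌊_⌋)
open import Relation.Binary.PropositionalEquality using (_≡_; _≢_)
open import Data.Bool.Properties using (T?)


-- The cycle C_N on Fin N (= Z/NZ): i ~ j iff j ≡ i+1 or i ≡ j+1 (mod N).
-- succ N i j : toℕ j ≡ (toℕ i + 1) mod N  (written without _%_ to avoid NonZero)
succ : (N : ℕ) → Fin N → Fin N → Bool
succ N i j = ⌊ toℕ j ≟ suc (toℕ i) ⌋ ∨ (⌊ suc (toℕ i) ≟ N ⌋ ∧ ⌊ toℕ j ≟ 0 ⌋)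

cycleAdj : (N : ℕ) → Fin N → Fin N → Bool
cycleAdj N i j = succ N i j ∨ succ N j i


record Graph : Set₁ where
  field
    Vtx   : Set
    verts : List Vtx
    E     : Vtx → Vtx → Bool

Cycle : (N : ℕ) → Graph
Cycle N = record { Vtx = Fin N ; verts = allFin N ; E = cycleAdj N }

boxCycles : (a b : ℕ) → Graph
boxCycles a b = record
  { Vtx   = Fin a × Fin b
  ; verts = cartesianProduct (allFin a) (allFin b)
  ; E     = λ { (g₁ , h₁) (g₂ , h₂) →
                (⌊ g₁ ≟ᶠ g₂ ⌋ ∧ cycleAdj b h₁ h₂) ∨ (⌊ h₁ ≟ᶠ h₂ ⌋ ∧ cycleAdj a g₁ g₂) }
  }

data Part : Set where
  R W₁ W₂ : Part

isPart : Part → Part → Bool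
isPart R R = true
isPart W₁ W₁ = true
isPart W₂ W₂ = true
isPart _ _ = false

nbrCount : (K : Graph) → (Graph.Vtx K → Part) → Graph.Vtx K → Part → ℕ
nbrCount K π v p =
  length (filter (λ u → T? (Graph.E K v u ∧ isPart (π u) p)) (Graph.verts K))

-- A barbell partition {R, W₁, W₂} of V(K), encoded as a labelling π : V(K) → Part
-- (so the three sets are disjoint and cover V(K); R may be empty).
record IsBarbellPartition (K : Graph) (π : Graph.Vtx K → Part) : Set where
  open Graph K
  field
    W₁-nonempty : ∃ λ v → π v ≡ W₁
    W₂-nonempty : ∃ λ v → π v ≡ W₂
    noEdgeW₁W₂  : ∀ u v → π u ≡ W₁ → π v ≡ W₂ → E u v ≡ false
    R-cond₁     : ∀ r → π r ≡ R → nbrCount K π r W₁ ≢ 1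
    R-cond₂     : ∀ r → π r ≡ R → nbrCount K π r W₂ ≢ 1

HasBarbellPartition : Graph → Set
HasBarbellPartition K = ∃ λ π → IsBarbellPartition K π

-- Put vertex (i , j) of C_k □ C_N into layer j − i (mod k), which is well defined as k ∣ N.
-- Every edge joins consecutive layers, and every vertex has two neighbours in the layer above
-- and two in the layer below. Take W₁ = layer 0, R = layers 1 and k − 1, W₂ = all other layers.
-- As k ≥ 4 the layers 1 and k − 1 separate W₁ from W₂ and border both of them, so every vertex
-- of R has at least two neighbours in W₁ and at least two in W₂.

module Submission where

open import Data.Bool using (T; _∧_)
open import Data.Bool.Properties using (T?; T-∨; T-∧; T-≡; ¬-not)
open import Data.Empty using (⊥-elim)
open import Data.Fin using (Fin; zero; toℕ)
open import Data.Fin.Properties using (toℕ<n; toℕ≤pred[n]; toℕ-fromℕ<) renaming (_≟_ to _≟ᶠ_)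
open import Data.List using (List; length; filter)
open import Data.List.Membership.Propositional using (_∈_)
open import Data.List.Membership.Propositional.Properties
  using (∈-length; ∈-filter⁺; ∈-allFin; ∈-cartesianProduct⁺)
open import Data.List.Relation.Unary.Any using (here; there)
open import Data.Nat using (ℕ; suc; _+_; _*_; _%_; _≤_; _<_; _≥_; s≤s; s≤s⁻¹; z≤n; NonZero)
open import Data.Nat.DivMod
  using (_mod_; m%n%n≡m%n; n%n≡0; m<n⇒m%n≡m; [m+n]%n≡m%n; %-distribˡ-+; %-distribˡ-*; m∣n⇒o%n%m≡o%m)
open import Data.Nat.Divisibility using (_∣_; n∣m*n)
open import Data.Nat.Properties
  using ( _≟_; suc-injective; +-suc; *-zeroʳ; ≤-refl; ≤-trans; <-irrefl; <⇒≤; <⇒≢; >⇒≢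
        ; ≤∧≢⇒<; m≤n⇒m≤1+n; *-mono-≤; 1+n≢n)
open import Data.Nat.Tactic.RingSolver using (solve-∀)
open import Data.Product using (_×_; _,_; proj₁)
import Data.Product as Product
open import Data.Sum using (_⊎_; inj₁; inj₂; swap)
import Data.Sum as Sum
open import Function.Base using (_∘_)
open import Function.Bundles using (_⇔_; mk⇔; Equivalence)
open import Level using (0ℓ)
open import Relation.Binary.Bundles using (Setoid)
import Relation.Binary.Construct.On as On
open import Relation.Binary.PropositionalEquality
  using (_≡_; _≢_; refl; sym; trans; cong; cong₂; subst; isEquivalence)
open import Relation.Binary.Structures using (IsEquivalence)
open import Relation.Nullary using (¬_; yes; no; contradiction)
open import Relation.Nullary.Decidable using (⌊_⌋; fromWitness; toWitness)

open import Defs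

open Equivalence using (to; from)

∈-distinct⇒2≤length : ∀ {A : Set} {x y : A} {xs : List A} →
                      x ∈ xs → y ∈ xs → x ≢ y → 2 ≤ length xs
∈-distinct⇒2≤length (here refl) (here refl) x≢y = contradiction refl x≢y
∈-distinct⇒2≤length (here _)    (there y∈)  _   = s≤s (∈-length y∈)
∈-distinct⇒2≤length (there x∈)  (here _)    _   = s≤s (∈-length x∈)
∈-distinct⇒2≤length (there x∈)  (there y∈)  x≢y = m≤n⇒m≤1+n (∈-distinct⇒2≤length x∈ y∈ x≢y)

isPart-refl : ∀ p → T (isPart p p)
isPart-refl R  = _
isPart-refl W₁ = _
isPart-refl W₂ = _

record TwoNeighbours (K : Graph) (P : Graph.Vtx K → Set) (v : Graph.Vtx K) : Set where
  constructor twoNeighbours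
  open Graph K
  field
    u₁ u₂     : Vtx
    distinct  : u₁ ≢ u₂
    adjacent₁ : T (E v u₁)
    adjacent₂ : T (E v u₂)
    holds₁    : P u₁
    holds₂    : P u₂

module _ {K : Graph} {P Q : Graph.Vtx K → Set} {v : Graph.Vtx K} where

  TwoNeighbours-map : (∀ {u} → P u → Q u) → TwoNeighbours K P v → TwoNeighbours K Q v
  TwoNeighbours-map f (twoNeighbours u₁ u₂ u₁≢u₂ adj₁ adj₂ p₁ p₂) =
    twoNeighbours u₁ u₂ u₁≢u₂ adj₁ adj₂ (f p₁) (f p₂)

module _ (K : Graph) (π : Graph.Vtx K → Part) (complete : ∀ v → v ∈ Graph.verts K) where
  open Graph K

  twoNeighbours⇒nbrCount≢1 : ∀ {v p} → TwoNeighbours K (λ u → π u ≡ p) v → nbrCount K π v p ≢ 1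
  twoNeighbours⇒nbrCount≢1 {v} {p} (twoNeighbours u₁ u₂ u₁≢u₂ adj₁ adj₂ πu₁ πu₂) =
    >⇒≢ (∈-distinct⇒2≤length (counted adj₁ πu₁) (counted adj₂ πu₂) u₁≢u₂)
    where
    counted : ∀ {u} → T (E v u) → π u ≡ p →
              u ∈ filter (λ w → T? (E v w ∧ isPart (π w) p)) verts
    counted {u} adj refl = ∈-filter⁺ _ (complete u) (from T-∧ (adj , isPart-refl (π u)))

-- Opaque because, unfolded, `T (succ n a b)` is a Boolean test from which unification
-- cannot recover a and b.
opaque
  Succ : ∀ {n} → Fin n → Fin n → Set
  Succ {n} a b = T (succ n a b)

  cycleAdj⇔Succ : ∀ {n} {a b : Fin n} → T (cycleAdj n a b) ⇔ (Succ a b ⊎ Succ b a)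
  cycleAdj⇔Succ = T-∨

module _ {M : ℕ} {a b : Fin (suc M)} where
  opaque
    unfolding Succ

    Succ-view : Succ a b → toℕ b ≡ suc (toℕ a) ⊎ (toℕ a ≡ M × toℕ b ≡ 0)
    Succ-view s with toℕ b ≟ suc (toℕ a) | suc (toℕ a) ≟ suc M | toℕ b ≟ 0
    ... | yes b≡1+a | _           | _       = inj₁ b≡1+a
    ... | no _      | yes 1+a≡1+M | yes b≡0 = inj₂ (suc-injective 1+a≡1+M , b≡0)
    ... | no _      | no _        | _       = ⊥-elim s
    ... | no _      | yes _       | no _    = ⊥-elim s

    Succ-intro : toℕ b ≡ suc (toℕ a) ⊎ (toℕ a ≡ M × toℕ b ≡ 0) → Succ a b
    Succ-intro h with toℕ b ≟ suc (toℕ a) | suc (toℕ a) ≟ suc M | toℕ b ≟ 0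
    Succ-intro _                 | yes _     | _           | _       = _
    Succ-intro (inj₁ b≡1+a)      | no b≢1+a  | _           | _       = contradiction b≡1+a b≢1+a
    Succ-intro (inj₂ _)          | no _      | yes _       | yes _   = _
    Succ-intro (inj₂ (a≡M , _))  | no _      | no 1+a≢1+M  | _       = contradiction (cong suc a≡M) 1+a≢1+M
    Succ-intro (inj₂ (_ , b≡0))  | no _      | yes _       | no b≢0  = contradiction b≡0 b≢0

  Succ-forward : toℕ a ≢ M → Succ a b → toℕ b ≡ suc (toℕ a)
  Succ-forward a≢M s with Succ-view s
  ... | inj₁ b≡1+a      = b≡1+a
  ... | inj₂ (a≡M , _)  = contradiction a≡M a≢M

  Succ-backward : toℕ b ≢ 0 → Succ a b → toℕ b ≡ suc (toℕ a)
  Succ-backward b≢0 s with Succ-view s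
  ... | inj₁ b≡1+a      = b≡1+a
  ... | inj₂ (_ , b≡0)  = contradiction b≡0 b≢0

  Succ-from-last : toℕ a ≡ M → Succ a b → toℕ b ≡ 0
  Succ-from-last a≡M s with Succ-view s
  ... | inj₁ b≡1+a      = contradiction (subst (_< suc M) (trans b≡1+a (cong suc a≡M)) (toℕ<n b)) (<-irrefl refl)
  ... | inj₂ (_ , b≡0)  = b≡0

  Succ-to-zero : toℕ b ≡ 0 → Succ a b → toℕ a ≡ M
  Succ-to-zero b≡0 s with Succ-view s
  ... | inj₁ b≡1+a      = contradiction (trans (sym b≡1+a) b≡0) λ ()
  ... | inj₂ (a≡M , _)  = a≡M

Succ-irrefl : ∀ {M} {a : Fin (suc M)} → 1 ≤ M → ¬ Succ a a
Succ-irrefl 1≤M s with Succ-view s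
... | inj₁ a≡1+a         = 1+n≢n (sym a≡1+a)
... | inj₂ (a≡M , a≡0)   = contradiction (subst (1 ≤_) (trans (sym a≡M) a≡0) 1≤M) λ ()

-- Opaque for the same reason as Succ.
opaque
  infix 4 _≡_[mod_]
  _≡_[mod_] : ℕ → ℕ → (n : ℕ) → .{{NonZero n}} → Set
  x ≡ y [mod n ] = x % n ≡ y % n

module _ {n : ℕ} .{{_ : NonZero n}} where
  opaque
    unfolding _≡_[mod_]

    ≡-mod-isEquivalence : IsEquivalence (λ x y → x ≡ y [mod n ])
    ≡-mod-isEquivalence = On.isEquivalence (_% n) isEquivalence

    +-cong-mod : ∀ {x x′ y y′} → x ≡ x′ [mod n ] → y ≡ y′ [mod n ] → x + y ≡ x′ + y′ [mod n ]
    +-cong-mod {x} {x′} {y} {y′} x≡x′ y≡y′ =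
      trans (%-distribˡ-+ x y n)
            (trans (cong₂ (λ r s → (r + s) % n) x≡x′ y≡y′) (sym (%-distribˡ-+ x′ y′ n)))

    *-cong-mod : ∀ {x x′ y y′} → x ≡ x′ [mod n ] → y ≡ y′ [mod n ] → x * y ≡ x′ * y′ [mod n ]
    *-cong-mod {x} {x′} {y} {y′} x≡x′ y≡y′ =
      trans (%-distribˡ-* x y n)
            (trans (cong₂ (λ r s → (r * s) % n) x≡x′ y≡y′) (sym (%-distribˡ-* x′ y′ n)))

    m+n≡m[mod-n] : ∀ m → m + n ≡ m [mod n ]
    m+n≡m[mod-n] m = [m+n]%n≡m%n m n

    toℕ-mod : ∀ x → toℕ (x mod n) ≡ x [mod n ]
    toℕ-mod x = trans (cong (_% n) (toℕ-fromℕ< _)) (m%n%n≡m%n x n)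

  ≡-mod-setoid : Setoid 0ℓ 0ℓ
  ≡-mod-setoid = record { isEquivalence = ≡-mod-isEquivalence }

  open IsEquivalence ≡-mod-isEquivalence public
    using () renaming (refl to ≡-mod-refl; sym to ≡-mod-sym)

opaque
  unfolding _≡_[mod_]

  ≡-mod-divisor : ∀ {d n x y} .{{_ : NonZero d}} .{{_ : NonZero n}} →
                  d ∣ n → x ≡ y [mod n ] → x ≡ y [mod d ]
  ≡-mod-divisor {d} {n} {x} {y} d∣n x≡y =
    trans (sym (m∣n⇒o%n%m≡o%m d n x d∣n)) (trans (cong (_% d) x≡y) (m∣n⇒o%n%m≡o%m d n y d∣n))

  Succ⇔suc≡[mod] : ∀ {M} {a b : Fin (suc M)} → Succ a b ⇔ suc (toℕ a) ≡ toℕ b [mod suc M ]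
  Succ⇔suc≡[mod] {M} {a} {b} = mk⇔ forward backward
    where
    b%≡b : toℕ b % suc M ≡ toℕ b
    b%≡b = m<n⇒m%n≡m (toℕ<n b)

    forward : Succ a b → suc (toℕ a) % suc M ≡ toℕ b % suc M
    forward s with Succ-view s
    ... | inj₁ b≡1+a       = cong (_% suc M) (sym b≡1+a)
    ... | inj₂ (a≡M , b≡0) =
      trans (cong (λ x → suc x % suc M) a≡M) (trans (n%n≡0 (suc M)) (cong (_% suc M) (sym b≡0)))

    backward : suc (toℕ a) % suc M ≡ toℕ b % suc M → Succ a b
    backward 1+a≡b with toℕ a ≟ M
    ... | yes a≡M = Succ-intro (inj₂ (a≡M , trans (sym b%≡b) (trans (sym 1+a≡b) 1+a%≡0)))
      where
      1+a%≡0 : suc (toℕ a) % suc M ≡ 0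
      1+a%≡0 = trans (cong (λ x → suc x % suc M) a≡M) (n%n≡0 (suc M))
    ... | no a≢M  = Succ-intro (inj₁ (trans (sym b%≡b) (trans (sym 1+a≡b) 1+a%≡1+a)))
      where
      1+a%≡1+a : suc (toℕ a) % suc M ≡ suc (toℕ a)
      1+a%≡1+a = m<n⇒m%n≡m (s≤s (≤∧≢⇒< (toℕ≤pred[n] a) a≢M))

module _ {M : ℕ} where
  open import Relation.Binary.Reasoning.Setoid (≡-mod-setoid {suc M})

  sucᶜ predᶜ : Fin (suc M) → Fin (suc M)
  sucᶜ j  = suc (toℕ j) mod suc M
  predᶜ j = (toℕ j + M) mod suc M

  Succ-sucᶜ : ∀ j → Succ j (sucᶜ j)
  Succ-sucᶜ j = from Succ⇔suc≡[mod] (≡-mod-sym (toℕ-mod (suc (toℕ j))))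

  Succ-predᶜ : ∀ j → Succ (predᶜ j) j
  Succ-predᶜ j = from Succ⇔suc≡[mod] (begin
    suc (toℕ (predᶜ j))  ≈⟨ +-cong-mod {x = 1} ≡-mod-refl (toℕ-mod (toℕ j + M)) ⟩
    suc (toℕ j + M)      ≡⟨ +-suc (toℕ j) M ⟨
    toℕ j + suc M        ≈⟨ m+n≡m[mod-n] (toℕ j) ⟩
    toℕ j                ∎)

module _ {a b : ℕ} where
  open Graph (boxCycles a b) using (E; verts)

  box-complete : ∀ v → v ∈ verts
  box-complete (i , j) = ∈-cartesianProduct⁺ (∈-allFin i) (∈-allFin j)

  box-horizontal : ∀ {g h₁ h₂} → Succ h₁ h₂ ⊎ Succ h₂ h₁ → T (E (g , h₁) (g , h₂))
  box-horizontal {g} {h₁} {h₂} adj =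
    from T-∨ (inj₁ (from T-∧ (fromWitness {a? = g ≟ᶠ g} refl , from (cycleAdj⇔Succ {b} {h₁} {h₂}) adj)))

  box-vertical : ∀ {g₁ g₂ h} → Succ g₁ g₂ ⊎ Succ g₂ g₁ → T (E (g₁ , h) (g₂ , h))
  box-vertical {g₁} {g₂} {h} adj =
    from T-∨ (inj₂ (from T-∧ (fromWitness {a? = h ≟ᶠ h} refl , from (cycleAdj⇔Succ {a} {g₁} {g₂}) adj)))

  box-edge-view : ∀ {g₁ g₂ h₁ h₂} → T (E (g₁ , h₁) (g₂ , h₂)) →
                  (g₁ ≡ g₂ × (Succ h₁ h₂ ⊎ Succ h₂ h₁)) ⊎ (h₁ ≡ h₂ × (Succ g₁ g₂ ⊎ Succ g₂ g₁))
  box-edge-view {g₁} {g₂} {h₁} {h₂} e =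
    Sum.map (Product.map toWitness (to (cycleAdj⇔Succ {b} {h₁} {h₂})) ∘ to (T-∧ {⌊ g₁ ≟ᶠ g₂ ⌋}))
            (Product.map toWitness (to (cycleAdj⇔Succ {a} {g₁} {g₂})) ∘ to (T-∧ {⌊ h₁ ≟ᶠ h₂ ⌋}))
            (to (T-∨ {⌊ g₁ ≟ᶠ g₂ ⌋ ∧ cycleAdj b h₁ h₂}) e)

record CyclicLayering (K : Graph) (n : ℕ) : Set where
  open Graph K
  field
    layer        : Vtx → Fin n
    complete     : ∀ v → v ∈ verts
    layer-hom    : ∀ {u v} → T (E u v) → Succ (layer u) (layer v) ⊎ Succ (layer v) (layer u)
    ascending    : ∀ v → TwoNeighbours K (λ u → Succ (layer v) (layer u)) v
    descending   : ∀ v → TwoNeighbours K (λ u → Succ (layer u) (layer v)) v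
    origin       : Vtx
    origin-layer : toℕ (layer origin) ≡ 0

layerPart : (top c : ℕ) → Part
layerPart top 0 = W₁
layerPart top 1 = R
layerPart top c@(suc (suc _)) with c ≟ top
... | yes _ = R
... | no _  = W₂

layerPart-W₁ : ∀ {top} c → layerPart top c ≡ W₁ → c ≡ 0
layerPart-W₁ 0 _ = refl
layerPart-W₁ 1 ()
layerPart-W₁ {top} (suc (suc c)) p with suc (suc c) ≟ top
layerPart-W₁ (suc (suc c)) () | yes _
layerPart-W₁ (suc (suc c)) () | no _

layerPart-R : ∀ {top} c → layerPart top c ≡ R → c ≡ 1 ⊎ c ≡ top
layerPart-R 1 _ = inj₁ refl
layerPart-R {top} (suc (suc c)) p with suc (suc c) ≟ top
layerPart-R (suc (suc c)) _  | yes c≡top = inj₂ c≡top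
layerPart-R (suc (suc c)) () | no _

layerPart-top : ∀ {top} → 2 ≤ top → layerPart top top ≡ R
layerPart-top {suc (suc t)} (s≤s (s≤s z≤n)) with suc (suc t) ≟ suc (suc t)
... | yes _   = refl
... | no t≢t  = contradiction refl t≢t

layerPart-W₂ : ∀ {top c} → 2 ≤ c → c ≢ top → layerPart top c ≡ W₂
layerPart-W₂ {top} {suc (suc c)} (s≤s (s≤s z≤n)) c≢top with suc (suc c) ≟ top
... | yes c≡top = contradiction c≡top c≢top
... | no _      = refl

module LayeredBarbell {K : Graph} {top : ℕ} (3≤top : 3 ≤ top) (L : CyclicLayering K (suc top)) where
  open Graph K
  open CyclicLayering L

  part : Vtx → Part
  part v = layerPart top (toℕ (layer v))

  part-≡ : ∀ {v c} → toℕ (layer v) ≡ c → part v ≡ layerPart top c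
  part-≡ = cong (layerPart top)

  ≤2⇒≢top : ∀ {c} → c ≤ 2 → c ≢ top
  ≤2⇒≢top c≤2 = <⇒≢ (≤-trans (s≤s c≤2) 3≤top)

  neighbour-of-layer-0 : ∀ {u v} → toℕ (layer u) ≡ 0 → T (E u v) → part v ≡ R
  neighbour-of-layer-0 u≡0 e with layer-hom e
  ... | inj₁ s = part-≡ (trans (Succ-forward (subst (_≢ top) (sym u≡0) (≤2⇒≢top z≤n)) s) (cong suc u≡0))
  ... | inj₂ s = trans (part-≡ (Succ-to-zero u≡0 s)) (layerPart-top (<⇒≤ 3≤top))

  W₁-W₂-nonadjacent : ∀ {u v} → part u ≡ W₁ → part v ≡ W₂ → ¬ T (E u v)
  W₁-W₂-nonadjacent {u} pu pv e
    with () ← trans (sym (neighbour-of-layer-0 (layerPart-W₁ (toℕ (layer u)) pu) e)) pv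

  below-layer-1 : ∀ {r u} → toℕ (layer r) ≡ 1 → Succ (layer u) (layer r) → part u ≡ W₁
  below-layer-1 r≡1 s = part-≡ (suc-injective (trans (sym (Succ-backward (subst (_≢ 0) (sym r≡1) λ ()) s)) r≡1))

  above-layer-1 : ∀ {r u} → toℕ (layer r) ≡ 1 → Succ (layer r) (layer u) → part u ≡ W₂
  above-layer-1 r≡1 s =
    trans (part-≡ (trans (Succ-forward (subst (_≢ top) (sym r≡1) (≤2⇒≢top (s≤s z≤n))) s) (cong suc r≡1)))
          (layerPart-W₂ ≤-refl (≤2⇒≢top ≤-refl))

  above-top : ∀ {r u} → toℕ (layer r) ≡ top → Succ (layer r) (layer u) → part u ≡ W₁
  above-top r≡top s = part-≡ (Succ-from-last r≡top s)

  below-top : ∀ {r u} → toℕ (layer r) ≡ top → Succ (layer u) (layer r) → part u ≡ W₂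
  below-top {r} {u} r≡top s = layerPart-W₂ (s≤s⁻¹ (subst (3 ≤_) top≡1+u 3≤top)) u≢top
    where
    top≡1+u : top ≡ suc (toℕ (layer u))
    top≡1+u = trans (sym r≡top) (Succ-backward (λ r≡0 → ≤2⇒≢top z≤n (trans (sym r≡0) r≡top)) s)

    u≢top : toℕ (layer u) ≢ top
    u≢top u≡top = 1+n≢n (trans (sym top≡1+u) (sym u≡top))

  layer-1-vertex : Vtx
  layer-1-vertex = TwoNeighbours.u₁ (ascending origin)

  layer-1-vertex-layer : toℕ (layer layer-1-vertex) ≡ 1
  layer-1-vertex-layer =
    trans (Succ-forward (subst (_≢ top) (sym origin-layer) (≤2⇒≢top z≤n))
                        (TwoNeighbours.holds₁ (ascending origin)))
          (cong suc origin-layer)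

  isBarbellPartition : IsBarbellPartition K part
  isBarbellPartition = record
    { W₁-nonempty = origin , part-≡ origin-layer
    ; W₂-nonempty = TwoNeighbours.u₁ (ascending layer-1-vertex)
                  , above-layer-1 layer-1-vertex-layer (TwoNeighbours.holds₁ (ascending layer-1-vertex))
    ; noEdgeW₁W₂  = λ u v pu pv → ¬-not (W₁-W₂-nonadjacent pu pv ∘ from T-≡)
    ; R-cond₁     = R-cond₁
    ; R-cond₂     = R-cond₂
    }
    where
    count : ∀ {r p} → TwoNeighbours K (λ u → part u ≡ p) r → nbrCount K part r p ≢ 1
    count = twoNeighbours⇒nbrCount≢1 K part complete

    R-cond₁ : ∀ r → part r ≡ R → nbrCount K part r W₁ ≢ 1
    R-cond₁ r pr with layerPart-R (toℕ (layer r)) pr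
    ... | inj₁ r≡1   = count (TwoNeighbours-map (below-layer-1 r≡1) (descending r))
    ... | inj₂ r≡top = count (TwoNeighbours-map (above-top r≡top) (ascending r))

    R-cond₂ : ∀ r → part r ≡ R → nbrCount K part r W₂ ≢ 1
    R-cond₂ r pr with layerPart-R (toℕ (layer r)) pr
    ... | inj₁ r≡1   = count (TwoNeighbours-map (above-layer-1 r≡1) (ascending r))
    ... | inj₂ r≡top = count (TwoNeighbours-map (below-top r≡top) (descending r))

cyclicLayering⇒barbellPartition : ∀ {K k} → 4 ≤ k → CyclicLayering K k → HasBarbellPartition K
cyclicLayering⇒barbellPartition {k = suc top} (s≤s 3≤top) L =
  LayeredBarbell.part 3≤top L , LayeredBarbell.isBarbellPartition 3≤top L

-- The layer of (i , j) is j − i modulo k, with k′ * i standing for −i.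
module TorusLayering {k′ N′ : ℕ} (1≤k′ : 1 ≤ k′) (k∣N : suc k′ ∣ suc N′) where
  open import Relation.Binary.Reasoning.Setoid (≡-mod-setoid {suc k′})

  k N : ℕ
  k = suc k′
  N = suc N′

  diagonal : Fin k × Fin N → ℕ
  diagonal (i , j) = toℕ j + k′ * toℕ i

  layer : Fin k × Fin N → Fin k
  layer v = diagonal v mod k

  Succ-horizontal : ∀ {i j j′} → Succ j j′ → Succ (layer (i , j)) (layer (i , j′))
  Succ-horizontal {i} {j} {j′} s = from Succ⇔suc≡[mod] (begin
    suc (toℕ (layer (i , j)))  ≈⟨ +-cong-mod {x = 1} ≡-mod-refl (toℕ-mod (diagonal (i , j))) ⟩
    suc (toℕ j) + k′ * toℕ i   ≈⟨ +-cong-mod (≡-mod-divisor k∣N (to Succ⇔suc≡[mod] s)) ≡-mod-refl ⟩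
    toℕ j′ + k′ * toℕ i        ≈⟨ ≡-mod-sym (toℕ-mod (diagonal (i , j′))) ⟩
    toℕ (layer (i , j′))       ∎)

  Succ-vertical : ∀ {i i′ j} → Succ i i′ → Succ (layer (i′ , j)) (layer (i , j))
  Succ-vertical {i} {i′} {j} s = from Succ⇔suc≡[mod] (begin
    suc (toℕ (layer (i′ , j)))      ≈⟨ +-cong-mod {x = 1} ≡-mod-refl (toℕ-mod (diagonal (i′ , j))) ⟩
    suc (toℕ j) + k′ * toℕ i′       ≈⟨ +-cong-mod {x = suc (toℕ j)} ≡-mod-refl
                                         (*-cong-mod {x = k′} ≡-mod-refl (≡-mod-sym (to Succ⇔suc≡[mod] s))) ⟩
    suc (toℕ j) + k′ * suc (toℕ i)  ≡⟨ shift k′ (toℕ j) (toℕ i) ⟩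
    diagonal (i , j) + k            ≈⟨ m+n≡m[mod-n] (diagonal (i , j)) ⟩
    diagonal (i , j)                ≈⟨ ≡-mod-sym (toℕ-mod (diagonal (i , j))) ⟩
    toℕ (layer (i , j))             ∎)
    where
    shift : ∀ k′ j i → suc j + k′ * suc i ≡ (j + k′ * i) + suc k′
    shift = solve-∀

  layer-hom : ∀ {u v} → T (Graph.E (boxCycles k N) u v) → Succ (layer u) (layer v) ⊎ Succ (layer v) (layer u)
  layer-hom {i , j} {i′ , j′} e with box-edge-view {g₁ = i} {i′} {j} {j′} e
  ... | inj₁ (refl , adj) = Sum.map (Succ-horizontal {i = i}) (Succ-horizontal {i = i}) adj
  ... | inj₂ (refl , adj) = swap (Sum.map (Succ-vertical {j = j}) (Succ-vertical {j = j}) adj)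

  ascending : ∀ v → TwoNeighbours (boxCycles k N) (λ u → Succ (layer v) (layer u)) v
  ascending (i , j) =
    twoNeighbours (i , sucᶜ j) (predᶜ i , j) distinct
      (box-horizontal (inj₁ (Succ-sucᶜ j))) (box-vertical (inj₂ (Succ-predᶜ i)))
      (Succ-horizontal {i = i} (Succ-sucᶜ j)) (Succ-vertical {j = j} (Succ-predᶜ i))
    where
    distinct : (i , sucᶜ j) ≢ (predᶜ i , j)
    distinct eq = Succ-irrefl 1≤k′ (subst (λ x → Succ x i) (sym (cong proj₁ eq)) (Succ-predᶜ i))

  descending : ∀ v → TwoNeighbours (boxCycles k N) (λ u → Succ (layer u) (layer v)) v
  descending (i , j) =
    twoNeighbours (i , predᶜ j) (sucᶜ i , j) distinct
      (box-horizontal (inj₂ (Succ-predᶜ j))) (box-vertical (inj₁ (Succ-sucᶜ i)))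
      (Succ-horizontal {i = i} (Succ-predᶜ j)) (Succ-vertical {j = j} (Succ-sucᶜ i))
    where
    distinct : (i , predᶜ j) ≢ (sucᶜ i , j)
    distinct eq = Succ-irrefl 1≤k′ (subst (Succ i) (sym (cong proj₁ eq)) (Succ-sucᶜ i))

  cyclicLayering : CyclicLayering (boxCycles k N) k
  cyclicLayering = record
    { layer        = layer
    ; complete     = box-complete
    ; layer-hom    = λ {u v} → layer-hom {u} {v}
    ; ascending    = ascending
    ; descending   = descending
    ; origin       = zero , zero
    ; origin-layer = trans (toℕ-fromℕ< _) (cong (_% k) (*-zeroʳ k′))
    }

torusCyclicLayering : ∀ {k N} → 2 ≤ k → 0 < N → k ∣ N → CyclicLayering (boxCycles k N) k
torusCyclicLayering {suc k′} {suc N′} (s≤s 1≤k′) (s≤s z≤n) k∣N = TorusLayering.cyclicLayering 1≤k′ k∣N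

mainTheorem17 : (m k : ℕ) → m ≥ 1 → k ≥ 4 →
    HasBarbellPartition (boxCycles k (m * k))
mainTheorem17 m k m≥1 k≥4 =
  cyclicLayering⇒barbellPartition k≥4
    (torusCyclicLayering (≤-trans (s≤s (s≤s z≤n)) k≥4) (*-mono-≤ m≥1 1≤k) (n∣m*n m))
  where
  1≤k : 1 ≤ k
  1≤k = ≤-trans (s≤s z≤n) k≥4
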